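{- If there exists a tight $\mathrm{SCCD}(v,k,b)$ with an outer expansion set, then there exists an economical $\mathrm{SCCD}(v+2,k,b')$ (with $b'=b+\frac{2v}{k-1}+1$).
   Context: An $\mathrm{SCCD}(v,k,b)$ (linear single change covering design) is a $v$-set $X$ with an ordered list $(B_1,\dots,B_b)$ of $k$-subsets of $X$ with $|B_i\cap B_{i+1}|=k-1$ for $1\le i<b$, such that every pair of elements of $X$ is contained in some block. Let $g_1=\frac{\binom{v}{2}-\binom{k}{2}}{k-1}+1$. The design is economical if $b=\lceil g_1\rceil$, and tight if it is economical and $g_1$ is an integer. The unchanged subsets are $U_i=B_i\cap B_{i+1}$ for $1\le i\le b-1$; in addition $U_0$ may be any $(k-1)$-subset of $B_1$ and $U_b$ any $(k-1)$-subset of $B_b$. An expansion set is a collection of $\frac{v}{k-1}$ unchanged subsets (distinct indices in $\{0,\dots,b\}$) that are pairwise disjoint with union $X$; it is outer if it contains $U_0$ or $U_b$. -}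

module Defs where

open import Data.Nat using (ℕ; zero; suc; _+_; _*_; _∸_; _≤_; _<_)
open import Data.Nat.Combinatorics using (_C_)
open import Data.Fin using (Fin; toℕ)
open import Data.Fin.Subset using (Subset; _∈_; _⊆_; _∩_; ∣_∣)
open import Data.Product using (Σ; ∃; _×_)
open import Data.Sum using (_⊎_)
open import Data.Empty using (⊥)
open import Relation.Binary.PropositionalEquality using (_≡_; _≢_)

-- Point set X = Fin v.  Blocks B_1,…,B_b are stored 0-indexed:
-- block j (j : Fin b) is B_{j+1}.
record SCCD (v k b : ℕ) : Set where
  field
    block     : Fin b → Subset v
    blockSize : ∀ (j : Fin b) → ∣ block j ∣ ≡ k
    single    : ∀ (j j′ : Fin b) → toℕ j′ ≡ suc (toℕ j) →
                ∣ block j ∩ block j′ ∣ ≡ k ∸ 1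
    covers    : ∀ (x y : Fin v) → x ≢ y →
                ∃ λ (j : Fin b) → x ∈ block j × y ∈ block j

open SCCD public

-- g₁ = (C(v,2) - C(k,2))/(k-1) + 1 (for k ≥ 2), rearranged to avoid
-- ℕ-subtraction/division.
-- Economical: b = ⌈g₁⌉, i.e.  b - 1 < g₁ ≤ b, i.e.
--   C(v,2) + (k-1) ≤ (k-1) b + C(k,2)  <  C(v,2) + 2 (k-1).
Economical : ℕ → ℕ → ℕ → Set
Economical v k b =
  (v C 2 + (k ∸ 1) ≤ (k ∸ 1) * b + k C 2) ×
  ((k ∸ 1) * b + k C 2 < v C 2 + 2 * (k ∸ 1))

-- Tight: economical and g₁ is an integer, i.e. b = g₁ exactly:
--   (k-1)(b-1) = C(v,2) - C(k,2).
Tight : ℕ → ℕ → ℕ → Set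
Tight v k b =
  Economical v k b × (v C 2 + (k ∸ 1) ≡ (k ∸ 1) * b + k C 2)

-- IsUnchanged D i S : S is a legitimate choice for U_i, i ∈ {0,…,b}.
--   U_0 : any (k-1)-subset of B_1;  U_b : any (k-1)-subset of B_b;
--   U_i = B_i ∩ B_{i+1} for 1 ≤ i ≤ b-1.
IsUnchanged : ∀ {v k b} → SCCD v k b → Fin (suc b) → Subset v → Set
IsUnchanged {v} {k} {b} D i S =
  (toℕ i ≡ 0 × Σ (Fin b) λ j → toℕ j ≡ 0 × S ⊆ block D j × ∣ S ∣ ≡ k ∸ 1)
  ⊎ ((toℕ i ≡ b × Σ (Fin b) λ j → suc (toℕ j) ≡ b × S ⊆ block D j × ∣ S ∣ ≡ k ∸ 1)
  ⊎ (Σ (Fin b) λ j → Σ (Fin b) λ j′ →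
       suc (toℕ j) ≡ toℕ i × toℕ j′ ≡ toℕ i × S ≡ block D j ∩ block D j′))

record ExpansionSet {v k b : ℕ} (D : SCCD v k b) : Set where
  field
    size     : ℕ
    count    : (k ∸ 1) * size ≡ v
    index    : Fin size → Fin (suc b)
    distinct : ∀ (a a′ : Fin size) → index a ≡ index a′ → a ≡ a′
    member   : Fin size → Subset v
    unchanged : ∀ (a : Fin size) → IsUnchanged D (index a) (member a)
    disjoint : ∀ (a a′ : Fin size) → a ≢ a′ →
               ∀ (x : Fin v) → x ∈ member a → x ∈ member a′ → ⊥
    union    : ∀ (x : Fin v) → ∃ λ (a : Fin size) → x ∈ member a

open ExpansionSet public

Outer : ∀ {v k b} {D : SCCD v k b} → ExpansionSet D → Set
Outer {b = b} E =
  ∃ λ (a : Fin (size E)) → toℕ (index E a) ≡ 0 ⊎ toℕ (index E a) ≡ b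

{-# OPTIONS --safe #-}
-- Add two new points p and q and keep every old block.  At the position of each
-- unchanged subset U of the expansion set insert the blocks U + p, U + q: U lies in
-- both neighbouring blocks, so consecutive blocks still meet in k - 1 points.  The
-- members of the expansion set partition X, so every pair {u, p} and {u, q} is
-- covered; the pair {p, q} is covered by putting (U - z) + p + q between U + p and
-- U + q for a single member U.  This adds 2v/(k - 1) + 1 blocks, and tightness of
-- the old design turns that count into economy of the new one.
module Submission where

open import Defs
open import Data.Nat using (ℕ; zero; suc; _+_; _*_; _∸_; _≤_; s≤s; z≤n)
open import Data.Nat.Properties using (+-comm; +-identityʳ; *-zeroʳ; suc-injective; m≤m+n; ≤-reflexive; <-irrefl; +-0-commutativeMonoid)
open import Data.Nat.Combinatorics using (_C_; nC1≡n; nCk+nC[k+1]≡[n+1]C[k+1])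
open import Data.Nat.Tactic.RingSolver using (solve-∀)
import Data.Nat.ListAction as List
open import Data.Bool using (true; false; if_then_else_)
open import Data.Fin using (Fin; zero; suc; toℕ; _↑ˡ_; _↑ʳ_)
open import Data.Fin.Patterns using (0F; 1F)
open import Data.Fin.Properties using (toℕ-injective; toℕ<n; _≟_)
open import Data.Fin.Subset using (Subset; inside; outside; _∈_; _⊆_; _∩_; _-_; ∣_∣; ⊥; ⊤; ⁅_⁆; Nonempty)
open import Data.Fin.Subset.Properties using (drop-∷-⊆; ∩-idem; ∩-comm; p∩q⊆p; p∩q⊆q; p─q⊆p; p─⊥≡p; nonempty?; Empty-unique; ∣⊥∣≡0)
open import Data.Vec using ([]; _∷_; _++_)
open import Data.Vec.Base using (here; there)
open import Data.Vec.Properties using (zipWith-++; lookup-++ˡ; lookup-++ʳ; lookup⇒[]=; []=⇒lookup)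
open import Data.List using (List; []; _∷_; length; head; last; concatMap; filter; map; allFin; lookup; tabulate)
import Data.List as L
open import Data.List.Properties using (length-++; ++-identityʳ; map-tabulate)
open import Data.List.Relation.Unary.All as All using (All)
open import Data.List.Relation.Unary.All.Properties as All using (all-filter)
import Data.List.Relation.Unary.Any as Any
open import Data.List.Relation.Unary.Any.Properties using (lookup-index)
open import Data.List.Relation.Unary.Linked as Linked using (Linked; [-])
open import Data.List.Relation.Unary.Linked.Properties using (++⁺)
open import Data.List.Relation.Unary.Unique.Propositional using (Unique)
open import Data.List.Relation.Unary.Unique.Propositional.Properties using (allFin⁺; filter⁺)
open import Data.List.Relation.Unary.AllPairs using (_∷_)
open import Data.List.Membership.Propositional using () renaming (_∈_ to _∈ˡ_)
open import Data.List.Membership.Propositional.Properties using (∈-++⁺ˡ; ∈-++⁺ʳ; ∈-filter⁺; ∈-allFin; ∈-lookup)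
open import Data.Maybe using (just)
open import Data.Maybe.Relation.Binary.Connected using (Connected; just; just-nothing; nothing-just)
open import Data.Product using (Σ; ∃; _×_; _,_; proj₁; proj₂)
open import Data.Sum using (_⊎_; inj₁; inj₂)
open import Data.Empty using (⊥-elim)
open import Function using (_∘_; id)
open import Relation.Nullary using (does; yes; no)
open import Relation.Nullary.Decidable using (dec-true)
open import Relation.Binary.PropositionalEquality
open import Algebra.Properties.CommutativeMonoid.Sum +-0-commutativeMonoid using (sum-syntax; sum-cong-≗; ∑-distrib-+)

∣p++q∣≡∣p∣+∣q∣ : ∀ {m n} (p : Subset m) (q : Subset n) → ∣ p ++ q ∣ ≡ ∣ p ∣ + ∣ q ∣
∣p++q∣≡∣p∣+∣q∣ []            q = refl
∣p++q∣≡∣p∣+∣q∣ (inside  ∷ p) q = cong suc (∣p++q∣≡∣p∣+∣q∣ p q)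
∣p++q∣≡∣p∣+∣q∣ (outside ∷ p) q = ∣p++q∣≡∣p∣+∣q∣ p q

∣p++q∩r++s∣ : ∀ {m n} (p r : Subset m) (q s : Subset n) →
              ∣ (p ++ q) ∩ (r ++ s) ∣ ≡ ∣ p ∩ r ∣ + ∣ q ∩ s ∣
∣p++q∩r++s∣ p r q s = begin
  ∣ (p ++ q) ∩ (r ++ s) ∣       ≡⟨ cong ∣_∣ (zipWith-++ _ p q r s) ⟩
  ∣ (p ∩ r) ++ (q ∩ s) ∣        ≡⟨ ∣p++q∣≡∣p∣+∣q∣ (p ∩ r) (q ∩ s) ⟩
  ∣ p ∩ r ∣ + ∣ q ∩ s ∣         ∎
  where open ≡-Reasoning

p⊆q⇒p∩q≡p : ∀ {n} {p q : Subset n} → p ⊆ q → p ∩ q ≡ p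
p⊆q⇒p∩q≡p {p = []}          {[]}          _   = refl
p⊆q⇒p∩q≡p {p = inside  ∷ p} {inside  ∷ q} p⊆q = cong (inside ∷_) (p⊆q⇒p∩q≡p (drop-∷-⊆ p⊆q))
p⊆q⇒p∩q≡p {p = inside  ∷ p} {outside ∷ q} p⊆q with () ← p⊆q here
p⊆q⇒p∩q≡p {p = outside ∷ p} {_       ∷ q} p⊆q = cong (outside ∷_) (p⊆q⇒p∩q≡p (drop-∷-⊆ p⊆q))

p⊆q⇒q∩p≡p : ∀ {n} {p q : Subset n} → p ⊆ q → q ∩ p ≡ p
p⊆q⇒q∩p≡p {p = p} {q} p⊆q = trans (∩-comm q p) (p⊆q⇒p∩q≡p p⊆q)

x∈p⇒1+∣p-x∣≡∣p∣ : ∀ {n} {x : Fin n} {p : Subset n} → x ∈ p → suc ∣ p - x ∣ ≡ ∣ p ∣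
x∈p⇒1+∣p-x∣≡∣p∣ {x = zero}  {inside  ∷ p} here       = cong (suc ∘ ∣_∣) (p─⊥≡p p)
x∈p⇒1+∣p-x∣≡∣p∣ {x = suc x} {inside  ∷ p} (there x∈p) = cong suc (x∈p⇒1+∣p-x∣≡∣p∣ x∈p)
x∈p⇒1+∣p-x∣≡∣p∣ {x = suc x} {outside ∷ p} (there x∈p) = x∈p⇒1+∣p-x∣≡∣p∣ x∈p

∣p∣≡1+m⇒Nonempty : ∀ {n m} (p : Subset n) → ∣ p ∣ ≡ suc m → Nonempty p
∣p∣≡1+m⇒Nonempty {n} p ∣p∣≡1+m with nonempty? p
... | yes p≢∅ = p≢∅
... | no  p≡∅ with () ← trans (sym ∣p∣≡1+m) (trans (cong ∣_∣ (Empty-unique p≡∅)) (∣⊥∣≡0 n))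

x∈p⇒x↑ˡ∈p++q : ∀ {m n} {x : Fin m} {p : Subset m} (q : Subset n) → x ∈ p → x ↑ˡ n ∈ p ++ q
x∈p⇒x↑ˡ∈p++q {x = x} {p} q x∈p = lookup⇒[]= (x ↑ˡ _) (p ++ q) (trans (lookup-++ˡ p q x) ([]=⇒lookup x∈p))

x∈q⇒m↑ʳx∈p++q : ∀ {m n} {x : Fin n} (p : Subset m) {q : Subset n} → x ∈ q → m ↑ʳ x ∈ p ++ q
x∈q⇒m↑ʳx∈p++q {m} {x = x} p {q} x∈q = lookup⇒[]= (m ↑ʳ x) (p ++ q) (trans (lookup-++ʳ p q x) ([]=⇒lookup x∈q))

∑-const : ∀ n c → ∑[ i < n ] c ≡ n * c
∑-const zero    c = refl
∑-const (suc n) c = cong (c +_) (∑-const n c)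

∑-indicator : ∀ {n} (j : Fin n) c → ∑[ i < n ] (if does (j ≟ i) then c else 0) ≡ c
∑-indicator {suc n} zero    c = trans (cong (c +_) (trans (∑-const n 0) (*-zeroʳ n))) (+-identityʳ c)
∑-indicator {suc n} (suc j) c = ∑-indicator j c

sum-map-allFin : ∀ n (f : Fin n → ℕ) → List.sum (map f (allFin n)) ≡ ∑[ i < n ] f i
sum-map-allFin n f = trans (cong List.sum (map-tabulate id f)) (sum-tabulate n f)
  where
  sum-tabulate : ∀ n (f : Fin n → ℕ) → List.sum (tabulate f) ≡ ∑[ i < n ] f i
  sum-tabulate zero    f = refl
  sum-tabulate (suc n) f = cong (f zero +_) (sum-tabulate n (f ∘ suc))

module Fibres {m n} (idx : Fin m → Fin n) where

  fibre : Fin n → List (Fin m) → List (Fin m)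
  fibre i = filter (λ a → idx a ≟ i)

  ∑-fibres : (f : Fin m → ℕ) (as : List (Fin m)) →
             ∑[ i < n ] List.sum (map f (fibre i as)) ≡ List.sum (map f as)
  ∑-fibres f []       = trans (∑-const n 0) (*-zeroʳ n)
  ∑-fibres f (a ∷ as) = begin
    ∑[ i < n ] List.sum (map f (fibre i (a ∷ as)))
      ≡⟨ sum-cong-≗ fibre-cons ⟩
    ∑[ i < n ] ((if does (idx a ≟ i) then f a else 0) + List.sum (map f (fibre i as)))
      ≡⟨ ∑-distrib-+ {n} _ _ ⟩
    ∑[ i < n ] (if does (idx a ≟ i) then f a else 0) + ∑[ i < n ] List.sum (map f (fibre i as))
      ≡⟨ cong₂ _+_ (∑-indicator (idx a) (f a)) (∑-fibres f as) ⟩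
    f a + List.sum (map f as)
      ∎
    where
    open ≡-Reasoning
    fibre-cons : ∀ i → List.sum (map f (fibre i (a ∷ as))) ≡
                 (if does (idx a ≟ i) then f a else 0) + List.sum (map f (fibre i as))
    fibre-cons i with does (idx a ≟ i)
    ... | true  = refl
    ... | false = refl

  fibre-injective : (∀ a a′ → idx a ≡ idx a′ → a ≡ a′) → ∀ i →
                    fibre i (allFin m) ≡ [] ⊎ ∃ λ a → idx a ≡ i × fibre i (allFin m) ≡ a ∷ []
  fibre-injective inj i =
    go (fibre i (allFin m)) (filter⁺ (λ a → idx a ≟ i) (allFin⁺ m)) (all-filter (λ a → idx a ≟ i) (allFin m))
    where
    go : ∀ as → Unique as → All (λ a → idx a ≡ i) as → as ≡ [] ⊎ ∃ λ a → idx a ≡ i × as ≡ a ∷ []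
    go []           _                      _                    = inj₁ refl
    go (a ∷ [])     _                      (idx-a≡i All.∷ _)    = inj₂ (a , idx-a≡i , refl)
    go (a ∷ a′ ∷ _) ((a≢a′ All.∷ _) ∷ _) (p All.∷ p′ All.∷ _) = ⊥-elim (a≢a′ (inj a a′ (trans p (sym p′))))

length-concatMap : ∀ {A B : Set} (f : A → List B) xs → length (concatMap f xs) ≡ List.sum (map (length ∘ f) xs)
length-concatMap f []       = refl
length-concatMap f (x ∷ xs) = trans (length-++ (f x)) (cong (length (f x) +_) (length-concatMap f xs))

module _ {A : Set} where

  interleave : ∀ n → (Fin n → A) → (Fin (suc n) → List A) → List A
  interleave zero    blk gap = gap zero
  interleave (suc n) blk gap = gap zero L.++ blk zero ∷ interleave n (blk ∘ suc) (gap ∘ suc)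

  length-interleave : ∀ n (blk : Fin n → A) gap →
                      length (interleave n blk gap) ≡ n + ∑[ i < suc n ] length (gap i)
  length-interleave zero    blk gap = sym (+-identityʳ _)
  length-interleave (suc n) blk gap = begin
    length (interleave (suc n) blk gap)
      ≡⟨ length-++ (gap zero) ⟩
    length (gap zero) + suc (length (interleave n (blk ∘ suc) (gap ∘ suc)))
      ≡⟨ cong (λ t → length (gap zero) + suc t) (length-interleave n (blk ∘ suc) (gap ∘ suc)) ⟩
    length (gap zero) + suc (n + ∑[ i < suc n ] length (gap (suc i)))
      ≡⟨ rearrange (length (gap zero)) n _ ⟩
    suc n + (length (gap zero) + ∑[ i < suc n ] length (gap (suc i)))
      ∎
    where
    open ≡-Reasoning
    rearrange : ∀ a n s → a + suc (n + s) ≡ suc n + (a + s)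
    rearrange = solve-∀

  module _ {R : A → A → Set} where

    head-interleave : ∀ n x (blk : Fin n → A) gap →
                      Connected R (just x) (head (gap zero)) → (∀ j → toℕ j ≡ 0 → R x (blk j)) →
                      Connected R (just x) (head (interleave n blk gap))
    head-interleave zero    x blk gap x~gap₀ _      = x~gap₀
    head-interleave (suc n) x blk gap x~gap₀ x~blk with gap zero
    ... | []    = just (x~blk zero refl)
    ... | _ ∷ _ = x~gap₀

    interleave-Linked : ∀ n (blk : Fin n → A) gap →
      (∀ i → Linked R (gap i)) →
      (∀ j j′ → toℕ j′ ≡ suc (toℕ j) → R (blk j) (blk j′)) →
      (∀ i j → toℕ i ≡ suc (toℕ j) → Connected R (just (blk j)) (head (gap i))) →
      (∀ i j → toℕ i ≡ toℕ j → Connected R (last (gap i)) (just (blk j))) →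
      Linked R (interleave n blk gap)
    interleave-Linked zero    blk gap gap↗ _    _       _       = gap↗ zero
    interleave-Linked (suc n) blk gap gap↗ blk↗ blk~gap gap~blk =
      ++⁺ (gap↗ zero) (gap~blk zero zero refl) (++⁺ [-] blk₀~rest rest↗)
      where
      blk₀~rest : Connected R (just (blk zero)) (head (interleave n (blk ∘ suc) (gap ∘ suc)))
      blk₀~rest = head-interleave n (blk zero) (blk ∘ suc) (gap ∘ suc)
        (blk~gap 1F zero refl) (λ j j≡0 → blk↗ zero (suc j) (cong suc j≡0))
      rest↗ : Linked R (interleave n (blk ∘ suc) (gap ∘ suc))
      rest↗ = interleave-Linked n (blk ∘ suc) (gap ∘ suc) (gap↗ ∘ suc)
        (λ j j′ e → blk↗ (suc j) (suc j′) (cong suc e))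
        (λ i j e → blk~gap (suc i) (suc j) (cong suc e))
        (λ i j e → gap~blk (suc i) (suc j) (cong suc e))

  interleave-All : ∀ {P : A → Set} n (blk : Fin n → A) gap →
                   (∀ j → P (blk j)) → (∀ i → All P (gap i)) → All P (interleave n blk gap)
  interleave-All zero    blk gap P-blk P-gap = P-gap zero
  interleave-All (suc n) blk gap P-blk P-gap =
    All.++⁺ (P-gap zero) (P-blk zero All.∷ interleave-All n (blk ∘ suc) (gap ∘ suc) (P-blk ∘ suc) (P-gap ∘ suc))

  blk∈interleave : ∀ n (blk : Fin n → A) gap j → blk j ∈ˡ interleave n blk gap
  blk∈interleave (suc n) blk gap zero    = ∈-++⁺ʳ (gap zero) (Any.here refl)
  blk∈interleave (suc n) blk gap (suc j) = ∈-++⁺ʳ (gap zero) (Any.there (blk∈interleave n (blk ∘ suc) (gap ∘ suc) j))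

  gap⊆interleave : ∀ n (blk : Fin n → A) gap i {x} → x ∈ˡ gap i → x ∈ˡ interleave n blk gap
  gap⊆interleave zero    blk gap zero    x∈gap = x∈gap
  gap⊆interleave (suc n) blk gap zero    x∈gap = ∈-++⁺ˡ x∈gap
  gap⊆interleave (suc n) blk gap (suc i) x∈gap =
    ∈-++⁺ʳ (gap zero) (Any.there (gap⊆interleave n (blk ∘ suc) (gap ∘ suc) i x∈gap))

  Linked-lookup : ∀ {R : A → A → Set} {xs} → Linked R xs →
                  ∀ (j j′ : Fin (length xs)) → toℕ j′ ≡ suc (toℕ j) → R (lookup xs j) (lookup xs j′)
  Linked-lookup (r Linked.∷ _)  zero    (suc zero) _ = r
  Linked-lookup (_ Linked.∷ rs) (suc j) (suc j′)   e = Linked-lookup rs j j′ (suc-injective e)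

module _ {v k b} (D : SCCD v k b) {i : Fin (suc b)} {U : Subset v} where

  unchanged-size : IsUnchanged D i U → ∣ U ∣ ≡ k ∸ 1
  unchanged-size (inj₁ (_ , _ , _ , _ , ∣U∣≡k-1))        = ∣U∣≡k-1
  unchanged-size (inj₂ (inj₁ (_ , _ , _ , _ , ∣U∣≡k-1))) = ∣U∣≡k-1
  unchanged-size (inj₂ (inj₂ (j , j′ , j+1≡i , j′≡i , refl))) = single D j j′ (trans j′≡i (sym j+1≡i))

  unchanged⊆preceding : IsUnchanged D i U → ∀ j → toℕ i ≡ suc (toℕ j) → U ⊆ block D j
  unchanged⊆preceding (inj₁ (i≡0 , _)) j i≡j+1 with () ← trans (sym i≡0) i≡j+1
  unchanged⊆preceding (inj₂ (inj₁ (i≡b , j″ , j″+1≡b , U⊆B , _))) j i≡j+1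
    rewrite toℕ-injective (suc-injective (trans j″+1≡b (trans (sym i≡b) i≡j+1))) = U⊆B
  unchanged⊆preceding (inj₂ (inj₂ (j₁ , j₂ , j₁+1≡i , _ , refl))) j i≡j+1
    rewrite toℕ-injective (suc-injective (trans j₁+1≡i i≡j+1)) = p∩q⊆p _ _

  unchanged⊆following : IsUnchanged D i U → ∀ j → toℕ i ≡ toℕ j → U ⊆ block D j
  unchanged⊆following (inj₁ (i≡0 , j″ , j″≡0 , U⊆B , _)) j i≡j
    rewrite toℕ-injective (trans j″≡0 (trans (sym i≡0) i≡j)) = U⊆B
  unchanged⊆following (inj₂ (inj₁ (i≡b , _))) j i≡j = ⊥-elim (<-irrefl (trans (sym i≡j) i≡b) (toℕ<n j))
  unchanged⊆following (inj₂ (inj₂ (j₁ , j₂ , _ , j₂≡i , refl))) j i≡j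
    rewrite toℕ-injective (trans j₂≡i i≡j) = p∩q⊆q _ _

data ExtendedPoint (v : ℕ) : Fin (v + 2) → Set where
  old  : ∀ u → ExtendedPoint v (u ↑ˡ 2)
  newP : ExtendedPoint v (v ↑ʳ 0F)
  newQ : ExtendedPoint v (v ↑ʳ 1F)

extendedPoint : ∀ v x → ExtendedPoint v x
extendedPoint zero    zero          = newP
extendedPoint zero    (suc zero)    = newQ
extendedPoint (suc v) zero          = old zero
extendedPoint (suc v) (suc x) with extendedPoint v x
... | old u = old (suc u)
... | newP  = newP
... | newQ  = newQ

module Extension {v m b} (D : SCCD v (2 + m) b) (E : ExpansionSet D) (a₀ : Fin (size E)) where

  open Fibres (index E)

  -- Subset (v + 2) is Subset v ++ Subset 2: the new points p and q are v ↑ʳ 0F and v ↑ʳ 1F.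
  Adjacent : Subset (v + 2) → Subset (v + 2) → Set
  Adjacent S T = ∣ S ∩ T ∣ ≡ suc m

  adjacent-++ : ∀ (S T : Subset v) (s t : Subset 2) → ∣ S ∩ T ∣ + ∣ s ∩ t ∣ ≡ suc m → Adjacent (S ++ s) (T ++ t)
  adjacent-++ S T s t = trans (∣p++q∩r++s∣ S T s t)

  U : Fin (size E) → Subset v
  U = member E

  ∣U∣≡1+m : ∀ a → ∣ U a ∣ ≡ suc m
  ∣U∣≡1+m a = unchanged-size D (unchanged E a)

  U-nonempty : ∀ a → Nonempty (U a)
  U-nonempty a = ∣p∣≡1+m⇒Nonempty (U a) (∣U∣≡1+m a)

  z : Fin (size E) → Fin v
  z a = proj₁ (U-nonempty a)

  ∣U-z∣≡m : ∀ a → ∣ U a - z a ∣ ≡ m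
  ∣U-z∣≡m a = suc-injective (trans (x∈p⇒1+∣p-x∣≡∣p∣ (proj₂ (U-nonempty a))) (∣U∣≡1+m a))

  P Q W : Fin (size E) → Subset (v + 2)
  P a = U a ++ ⁅ 0F ⁆
  Q a = U a ++ ⁅ 1F ⁆
  W a = (U a - z a) ++ ⊤

  gadget : Fin (size E) → List (Subset (v + 2))
  gadget a = if does (a₀ ≟ a) then P a ∷ W a ∷ Q a ∷ [] else P a ∷ Q a ∷ []

  gap : Fin (suc b) → List (Subset (v + 2))
  gap i = concatMap gadget (fibre i (allFin (size E)))

  blocks : List (Subset (v + 2))
  blocks = interleave b (λ j → block D j ++ ⊥) gap

  P~Q : ∀ a → Adjacent (P a) (Q a)
  P~Q a = adjacent-++ (U a) (U a) _ _ (trans (+-identityʳ _) (trans (cong ∣_∣ (∩-idem (U a))) (∣U∣≡1+m a)))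

  P~W : ∀ a → Adjacent (P a) (W a)
  P~W a = adjacent-++ (U a) (U a - z a) _ _
    (trans (+-comm _ 1) (cong suc (trans (cong ∣_∣ (p⊆q⇒q∩p≡p (p─q⊆p (U a) ⁅ z a ⁆))) (∣U-z∣≡m a))))

  W~Q : ∀ a → Adjacent (W a) (Q a)
  W~Q a = adjacent-++ (U a - z a) (U a) _ _
    (trans (+-comm _ 1) (cong suc (trans (cong ∣_∣ (p⊆q⇒p∩q≡p (p─q⊆p (U a) ⁅ z a ⁆))) (∣U-z∣≡m a))))

  block~P : ∀ a j → U a ⊆ block D j → Adjacent (block D j ++ ⊥) (P a)
  block~P a j U⊆B = adjacent-++ (block D j) (U a) ⊥ ⁅ 0F ⁆
    (trans (+-identityʳ _) (trans (cong ∣_∣ (p⊆q⇒q∩p≡p U⊆B)) (∣U∣≡1+m a)))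

  Q~block : ∀ a j → U a ⊆ block D j → Adjacent (Q a) (block D j ++ ⊥)
  Q~block a j U⊆B = adjacent-++ (U a) (block D j) ⁅ 1F ⁆ ⊥
    (trans (+-identityʳ _) (trans (cong ∣_∣ (p⊆q⇒p∩q≡p U⊆B)) (∣U∣≡1+m a)))

  gadget-Linked : ∀ a → Linked Adjacent (gadget a)
  gadget-Linked a with does (a₀ ≟ a)
  ... | true  = P~W a Linked.∷ W~Q a Linked.∷ [-]
  ... | false = P~Q a Linked.∷ [-]

  ∣P∣ : ∀ a → ∣ P a ∣ ≡ 2 + m
  ∣P∣ a = trans (∣p++q∣≡∣p∣+∣q∣ (U a) _) (trans (+-comm _ 1) (cong suc (∣U∣≡1+m a)))

  ∣Q∣ : ∀ a → ∣ Q a ∣ ≡ 2 + m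
  ∣Q∣ a = trans (∣p++q∣≡∣p∣+∣q∣ (U a) _) (trans (+-comm _ 1) (cong suc (∣U∣≡1+m a)))

  ∣W∣ : ∀ a → ∣ W a ∣ ≡ 2 + m
  ∣W∣ a = trans (∣p++q∣≡∣p∣+∣q∣ (U a - z a) _) (trans (+-comm _ 2) (cong (2 +_) (∣U-z∣≡m a)))

  gadget-size : ∀ a → All (λ S → ∣ S ∣ ≡ 2 + m) (gadget a)
  gadget-size a with does (a₀ ≟ a)
  ... | true  = ∣P∣ a All.∷ ∣W∣ a All.∷ ∣Q∣ a All.∷ All.[]
  ... | false = ∣P∣ a All.∷ ∣Q∣ a All.∷ All.[]

  head-gadget : ∀ a → head (gadget a) ≡ just (P a)
  head-gadget a with does (a₀ ≟ a)
  ... | true  = refl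
  ... | false = refl

  last-gadget : ∀ a → last (gadget a) ≡ just (Q a)
  last-gadget a with does (a₀ ≟ a)
  ... | true  = refl
  ... | false = refl

  length-gadget : ∀ a → length (gadget a) ≡ 2 + (if does (a₀ ≟ a) then 1 else 0)
  length-gadget a with does (a₀ ≟ a)
  ... | true  = refl
  ... | false = refl

  P∈gadget : ∀ a → P a ∈ˡ gadget a
  P∈gadget a with does (a₀ ≟ a)
  ... | true  = Any.here refl
  ... | false = Any.here refl

  Q∈gadget : ∀ a → Q a ∈ˡ gadget a
  Q∈gadget a with does (a₀ ≟ a)
  ... | true  = Any.there (Any.there (Any.here refl))
  ... | false = Any.there (Any.here refl)

  W₀∈gadget₀ : W a₀ ∈ˡ gadget a₀
  W₀∈gadget₀ rewrite dec-true (a₀ ≟ a₀) refl = Any.there (Any.here refl)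

  gap-shape : ∀ i → gap i ≡ [] ⊎ ∃ λ a → index E a ≡ i × gap i ≡ gadget a
  gap-shape i with fibre-injective (distinct E) i
  ... | inj₁ fibre≡[]              = inj₁ (cong (concatMap gadget) fibre≡[])
  ... | inj₂ (a , idx≡i , fibre≡a) = inj₂ (a , idx≡i , trans (cong (concatMap gadget) fibre≡a) (++-identityʳ _))

  gap-index : ∀ a → gap (index E a) ≡ gadget a
  gap-index a with fibre-injective (distinct E) (index E a)
  ... | inj₁ fibre≡[] with () ← subst (a ∈ˡ_) fibre≡[] (∈-filter⁺ (λ a′ → index E a′ ≟ index E a) (∈-allFin a) refl)
  ... | inj₂ (a′ , idx≡idx , fibre≡a′) rewrite distinct E a′ a idx≡idx =
    trans (cong (concatMap gadget) fibre≡a′) (++-identityʳ _)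

  blocks-Linked : Linked Adjacent blocks
  blocks-Linked = interleave-Linked b _ gap gap-Linked block~block block~gap gap~block
    where
    gap-Linked : ∀ i → Linked Adjacent (gap i)
    gap-Linked i with gap-shape i
    ... | inj₁ gap≡[]               rewrite gap≡[]      = Linked.[]
    ... | inj₂ (a , _ , gap≡gadget) rewrite gap≡gadget = gadget-Linked a

    block~block : ∀ j j′ → toℕ j′ ≡ suc (toℕ j) → Adjacent (block D j ++ ⊥) (block D j′ ++ ⊥)
    block~block j j′ j′≡j+1 = adjacent-++ (block D j) (block D j′) ⊥ ⊥ (trans (+-identityʳ _) (single D j j′ j′≡j+1))

    block~gap : ∀ i j → toℕ i ≡ suc (toℕ j) → Connected Adjacent (just (block D j ++ ⊥)) (head (gap i))
    block~gap i j i≡j+1 with gap-shape i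
    ... | inj₁ gap≡[] rewrite gap≡[] = just-nothing
    ... | inj₂ (a , refl , gap≡gadget) rewrite gap≡gadget | head-gadget a =
      just (block~P a j (unchanged⊆preceding D (unchanged E a) j i≡j+1))

    gap~block : ∀ i j → toℕ i ≡ toℕ j → Connected Adjacent (last (gap i)) (just (block D j ++ ⊥))
    gap~block i j i≡j with gap-shape i
    ... | inj₁ gap≡[] rewrite gap≡[] = nothing-just
    ... | inj₂ (a , refl , gap≡gadget) rewrite gap≡gadget | last-gadget a =
      just (Q~block a j (unchanged⊆following D (unchanged E a) j i≡j))

  blocks-size : All (λ S → ∣ S ∣ ≡ 2 + m) blocks
  blocks-size = interleave-All b _ gap
    (λ j → trans (∣p++q∣≡∣p∣+∣q∣ (block D j) ⊥) (trans (+-identityʳ _) (blockSize D j)))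
    gap-size
    where
    gap-size : ∀ i → All (λ S → ∣ S ∣ ≡ 2 + m) (gap i)
    gap-size i with gap-shape i
    ... | inj₁ gap≡[]               rewrite gap≡[]      = All.[]
    ... | inj₂ (a , _ , gap≡gadget) rewrite gap≡gadget = gadget-size a

  length-blocks : length blocks ≡ b + (size E * 2 + 1)
  length-blocks = begin
    length blocks
      ≡⟨ length-interleave b _ gap ⟩
    b + ∑[ i < suc b ] length (gap i)
      ≡⟨ cong (b +_) (sum-cong-≗ (λ i → length-concatMap gadget (fibre i (allFin (size E))))) ⟩
    b + ∑[ i < suc b ] List.sum (map (length ∘ gadget) (fibre i (allFin (size E))))
      ≡⟨ cong (b +_) (∑-fibres (length ∘ gadget) (allFin (size E))) ⟩
    b + List.sum (map (length ∘ gadget) (allFin (size E)))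
      ≡⟨ cong (b +_) (sum-map-allFin (size E) (length ∘ gadget)) ⟩
    b + ∑[ a < size E ] length (gadget a)
      ≡⟨ cong (b +_) (sum-cong-≗ length-gadget) ⟩
    b + ∑[ a < size E ] (2 + (if does (a₀ ≟ a) then 1 else 0))
      ≡⟨ cong (b +_) (∑-distrib-+ {size E} _ _) ⟩
    b + (∑[ a < size E ] 2 + ∑[ a < size E ] (if does (a₀ ≟ a) then 1 else 0))
      ≡⟨ cong (b +_) (cong₂ _+_ (∑-const (size E) 2) (∑-indicator a₀ 1)) ⟩
    b + (size E * 2 + 1)
      ∎
    where open ≡-Reasoning

  Covered : Fin (v + 2) → Fin (v + 2) → Set
  Covered x y = ∃ λ S → S ∈ˡ blocks × x ∈ S × y ∈ S

  gadget⊆blocks : ∀ a {S} → S ∈ˡ gadget a → S ∈ˡ blocks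
  gadget⊆blocks a S∈gadget = gap⊆interleave b _ gap (index E a) (subst (_ ∈ˡ_) (sym (gap-index a)) S∈gadget)

  covered-sym : ∀ {x y} → Covered x y → Covered y x
  covered-sym (S , S∈blocks , x∈S , y∈S) = S , S∈blocks , y∈S , x∈S

  covered-old-P : ∀ u → Covered (u ↑ˡ 2) (v ↑ʳ 0F)
  covered-old-P u with union E u
  ... | a , u∈U = P a , gadget⊆blocks a (P∈gadget a) , x∈p⇒x↑ˡ∈p++q _ u∈U , x∈q⇒m↑ʳx∈p++q (U a) here

  covered-old-Q : ∀ u → Covered (u ↑ˡ 2) (v ↑ʳ 1F)
  covered-old-Q u with union E u
  ... | a , u∈U = Q a , gadget⊆blocks a (Q∈gadget a) , x∈p⇒x↑ˡ∈p++q _ u∈U , x∈q⇒m↑ʳx∈p++q (U a) (there here)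

  covered-P-Q : Covered (v ↑ʳ 0F) (v ↑ʳ 1F)
  covered-P-Q = W a₀ , gadget⊆blocks a₀ W₀∈gadget₀ , x∈q⇒m↑ʳx∈p++q _ here , x∈q⇒m↑ʳx∈p++q _ (there here)

  covered : ∀ x y → x ≢ y → Covered x y
  covered x y x≢y with extendedPoint v x | extendedPoint v y
  ... | old u | old u′ with covers D u u′ (x≢y ∘ cong (_↑ˡ 2))
  ...   | j , u∈B , u′∈B = block D j ++ ⊥ , blk∈interleave b _ gap j , x∈p⇒x↑ˡ∈p++q ⊥ u∈B , x∈p⇒x↑ˡ∈p++q ⊥ u′∈B
  covered x y x≢y | old u | newP  = covered-old-P u
  covered x y x≢y | old u | newQ  = covered-old-Q u
  covered x y x≢y | newP  | old u = covered-sym (covered-old-P u)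
  covered x y x≢y | newQ  | old u = covered-sym (covered-old-Q u)
  covered x y x≢y | newP  | newQ  = covered-P-Q
  covered x y x≢y | newQ  | newP  = covered-sym covered-P-Q
  covered x y x≢y | newP  | newP  = ⊥-elim (x≢y refl)
  covered x y x≢y | newQ  | newQ  = ⊥-elim (x≢y refl)

  extended : SCCD (v + 2) (2 + m) (length blocks)
  extended = record
    { block     = lookup blocks
    ; blockSize = λ j → All.lookup blocks-size (∈-lookup j)
    ; single    = Linked-lookup blocks-Linked
    ; covers    = λ x y x≢y → in-block (covered x y x≢y)
    }
    where
    in-block : ∀ {x y} → Covered x y → ∃ λ j → x ∈ lookup blocks j × y ∈ lookup blocks j
    in-block (S , S∈blocks , x∈S , y∈S) =
      Any.index S∈blocks , subst (λ T → _ ∈ T × _ ∈ T) (lookup-index S∈blocks) (x∈S , y∈S)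

[n+2]C2 : ∀ n → (n + 2) C 2 ≡ suc (n + n + n C 2)
[n+2]C2 n rewrite +-comm n 2 = begin
  suc (suc n) C 2              ≡⟨ pascal (suc n) ⟩
  suc n + suc n C 2            ≡⟨ cong (suc n +_) (pascal n) ⟩
  suc n + (n + n C 2)          ≡⟨ rearrange n (n C 2) ⟩
  suc (n + n + n C 2)          ∎
  where
  open ≡-Reasoning
  pascal : ∀ n → suc n C 2 ≡ n + n C 2
  pascal n = trans (sym (nCk+nC[k+1]≡[n+1]C[k+1] n 1)) (cong (_+ n C 2) (nC1≡n n))
  rearrange : ∀ n c → suc n + (n + c) ≡ suc (n + n + c)
  rearrange = solve-∀

extension-length : ∀ {v} s b S → s * S ≡ v → s * (b + (S * 2 + 1)) ≡ s * (b + 1) + 2 * v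
extension-length s b S refl = distribute s b S
  where
  distribute : ∀ s b S → s * (b + (S * 2 + 1)) ≡ s * (b + 1) + 2 * (s * S)
  distribute = solve-∀

extension-economical : ∀ {v m b} S → Tight v (2 + m) b → suc m * S ≡ v →
                       Economical (v + 2) (2 + m) (b + (S * 2 + 1))
extension-economical {v} {m} {b} S (_ , tight) refl = lower , upper
  where
  open ≡-Reasoning
  total : suc m * (b + (S * 2 + 1)) + (2 + m) C 2 ≡ (v + 2) C 2 + suc m + m
  total = begin
    suc m * (b + (S * 2 + 1)) + (2 + m) C 2  ≡⟨ expand (suc m) b S ((2 + m) C 2) ⟩
    suc m * b + (2 + m) C 2 + suc m + 2 * v  ≡⟨ cong (λ t → t + suc m + 2 * v) (sym tight) ⟩
    v C 2 + suc m + suc m + 2 * v            ≡⟨ regroup (v C 2) m v ⟩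
    suc (v + v + v C 2) + suc m + m          ≡⟨ cong (λ t → t + suc m + m) (sym ([n+2]C2 v)) ⟩
    (v + 2) C 2 + suc m + m                  ∎
    where
    expand : ∀ s b S K → s * (b + (S * 2 + 1)) + K ≡ s * b + K + s + 2 * (s * S)
    expand = solve-∀
    regroup : ∀ c m v → c + suc m + suc m + 2 * v ≡ suc (v + v + c) + suc m + m
    regroup = solve-∀
  lower : (v + 2) C 2 + suc m ≤ suc m * (b + (S * 2 + 1)) + (2 + m) C 2
  lower rewrite total = m≤m+n _ m
  upper : suc (suc m * (b + (S * 2 + 1)) + (2 + m) C 2) ≤ (v + 2) C 2 + 2 * suc m
  upper rewrite total = ≤-reflexive (close ((v + 2) C 2) m)
    where
    close : ∀ c m → suc (c + suc m + m) ≡ c + 2 * suc m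
    close = solve-∀

corollary1 : ∀ {v k b : ℕ} → 2 ≤ k →
    (D : SCCD v k b) → Tight v k b →
    (E : ExpansionSet D) → Outer E →
    Σ ℕ λ b′ → ((k ∸ 1) * b′ ≡ (k ∸ 1) * (b + 1) + 2 * v) ×
      Economical (v + 2) k b′ × SCCD (v + 2) k b′
corollary1 {v} {suc (suc m)} {b} (s≤s (s≤s z≤n)) D tight E (a₀ , _) =
  length blocks ,
  subst (λ n → suc m * n ≡ suc m * (b + 1) + 2 * v) (sym length-blocks)
    (extension-length (suc m) b (size E) (count E)) ,
  subst (Economical (v + 2) (2 + m)) (sym length-blocks) (extension-economical (size E) tight (count E)) ,
  extended
  where open Extension D E a₀
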